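{- Let $D$ be a (not necessarily simple) $3$-regular acyclic directed graph with a unique source $s$ and a unique sink. Then there exists a total order $\preceq'$ on the vertices of $D$ such that every edge of $D$ is directed from its $\preceq'$-smaller endpoint to its $\preceq'$-larger endpoint, and such that $\mu_D$ is weakly increasing with respect to $\preceq'$, i.e. $x\preceq' y$ implies $\mu_D(x)\le\mu_D(y)$.
   Context: A directed multigraph is $3$-regular if every vertex is incident to exactly three edges counted with multiplicity. For a vertex $y$, $\mu_D(y)$ denotes the number of directed paths in $D$ from the source $s$ to $y$. -}

module Defs where

open import Data.Nat using (ℕ; zero; suc; _+_)
open import Data.Fin using (Fin)
open import Data.Fin.Properties using (_≟_)
open import Data.List using (List; []; _∷_; map; length; filter; allFin; concatMap; upTo)
open import Data.Nat.ListAction using (sum)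
open import Data.Maybe using (Maybe; just; nothing)
import Data.Maybe.Properties as MP
open import Data.Product using (_×_; Σ; _,_)
open import Relation.Binary.PropositionalEquality using (_≡_)
open import Relation.Nullary using (¬_; Dec; yes; no)
open import Relation.Nullary.Decidable using (_×-dec_)
import Data.List.Relation.Unary.Unique.DecPropositional as UDP
open import Data.List.Relation.Unary.Unique.Propositional using (Unique)

-- A finite directed multigraph: vertices Fin n, edges Fin m,
-- edge e goes from (tl e) to (hd e).  Parallel edges allowed.
record Digraph : Set where
  field
    n  : ℕ
    m  : ℕ
    tl : Fin m → Fin n
    hd : Fin m → Fin n

module _ (D : Digraph) where
  open Digraph D

  Vertex : Set
  Vertex = Fin n

  indeg : Vertex → ℕ
  indeg v = length (filter (λ e → hd e ≟ v) (allFin m))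

  outdeg : Vertex → ℕ
  outdeg v = length (filter (λ e → tl e ≟ v) (allFin m))

  -- 3-regular: every vertex is incident to exactly three edges
  -- (a loop would count twice; irrelevant for acyclic graphs)
  ThreeRegular : Set
  ThreeRegular = ∀ v → indeg v + outdeg v ≡ 3

  data _⇝⁺_ : Vertex → Vertex → Set where
    edge : (e : Fin m) → tl e ⇝⁺ hd e
    step : ∀ {u} (e : Fin m) → u ⇝⁺ tl e → u ⇝⁺ hd e

  Acyclic : Set
  Acyclic = ∀ v → ¬ (v ⇝⁺ v)

  IsSource : Vertex → Set
  IsSource v = indeg v ≡ 0

  IsSink : Vertex → Set
  IsSink v = outdeg v ≡ 0

  UniqueSource : Vertex → Set
  UniqueSource s = IsSource s × (∀ v → IsSource v → v ≡ s)

  HasUniqueSink : Set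
  HasUniqueSink = Σ Vertex λ t → IsSink t × (∀ v → IsSink v → v ≡ t)

  walkEnd : Vertex → List (Fin m) → Maybe Vertex
  walkEnd u [] = just u
  walkEnd u (e ∷ es) with tl e ≟ u
  ... | yes _ = walkEnd (hd e) es
  ... | no _  = nothing

  IsPath : Vertex → Vertex → List (Fin m) → Set
  IsPath x y es = (walkEnd x es ≡ just y) × Unique (x ∷ map hd es)

  isPath? : ∀ x y es → Dec (IsPath x y es)
  isPath? x y es = MP.≡-dec _≟_ (walkEnd x es) (just y) ×-dec UDP.unique? _≟_ (x ∷ map hd es)

  seqs : ℕ → List (List (Fin m))
  seqs zero = [] ∷ []
  seqs (suc k) = concatMap (λ e → map (e ∷_) (seqs k)) (allFin m)

  -- number of directed paths from x to y (a path visits at most n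
  -- vertices, so it has at most n - 1 edges; lengths 0..n are enumerated)
  numPaths : Vertex → Vertex → ℕ
  numPaths x y = sum (map (λ k → length (filter (isPath? x y) (seqs k))) (upTo (suc n)))

  μ : Vertex → Vertex → ℕ
  μ s y = numPaths s y

{-# OPTIONS --safe #-}
module Submission where

-- Order the vertices lexicographically by μ, then by the number pathsInto x
-- of all directed paths ending at x, then by index.  In an acyclic graph,
-- appending an edge u → v to a path ending at u gives a path ending at v,
-- injectively; so numPaths w u ≤ numPaths w v for every w, which for w = s
-- says that μ is monotone along edges.  For w = v the inequality is strict
-- (the trivial path at v, but no path from v back to u), so pathsInto
-- strictly increases along edges.  Hence every edge goes up in the
-- lexicographic order, and μ is monotone by construction.

open import Defs
open import Level using (0ℓ)
open import Data.Empty using (⊥-elim)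
open import Data.Nat using (ℕ; zero; suc; _+_; _≤_; _<_; z≤n; s≤s)
import Data.Nat.Properties as ℕ
open import Data.Nat.ListAction using (sum)
open import Data.Fin using (Fin) renaming (_≤_ to _≤ᶠ_)
import Data.Fin.Properties as Fin
open import Data.Fin.Properties using (_≟_)
open import Data.Maybe using (just)
open import Data.Product using (Σ; _×_; _,_)
open import Data.Product.Relation.Binary.Lex.NonStrict using (×-Lex; ×-isDecTotalOrder)
open import Data.Sum using (_⊎_; inj₁; inj₂)
open import Data.List
  using (List; []; _∷_; _++_; _∷ʳ_; map; length; filter; allFin; concatMap; upTo; applyUpTo;
         cartesianProductWith)
open import Data.List.Properties
  using (filter-none; filter-accept; map-applyUpTo; map-++; ∷ʳ-injectiveˡ; length-map; length-++;
         length-++-sucʳ; length-tabulate)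
open import Data.List.Membership.Propositional using (_∈_)
open import Data.List.Membership.Propositional.Properties
  using (∈-∃++; ∈-++⁻; ∈-++⁺ˡ; ∈-++⁺ʳ; ∈-filter⁺; ∈-filter⁻; ∈-allFin; ∈-map⁻;
         ∈-cartesianProductWith⁺; ∈-cartesianProductWith⁻)
open import Data.List.Relation.Binary.Subset.Propositional using (_⊆_)
open import Data.List.Relation.Unary.Any using (here; there)
open import Data.List.Relation.Unary.All as All using ([]; _∷_)
open import Data.List.Relation.Unary.AllPairs using ([]; _∷_)
open import Data.List.Relation.Unary.Unique.Propositional using (Unique)
import Data.List.Relation.Unary.Unique.Propositional.Properties as Unique
open import Function using (_∘_; _on_)
open import Relation.Nullary using (¬_; yes; no)
open import Relation.Binary.Core using (Rel)
open import Relation.Binary.Structures using (IsTotalOrder; IsDecTotalOrder)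
open import Relation.Binary.PropositionalEquality
  using (_≡_; _≢_; refl; sym; trans; cong; cong₂; subst; isEquivalence)
open ℕ.≤-Reasoning

Unique-⊆⇒length≤ : {A : Set} {xs ys : List A} → Unique xs → xs ⊆ ys → length xs ≤ length ys
Unique-⊆⇒length≤ {xs = []} _ _ = z≤n
Unique-⊆⇒length≤ {xs = x ∷ xs} (x∉xs ∷ xs!) x∷xs⊆ys
  with ys₁ , ys₂ , refl ← ∈-∃++ (x∷xs⊆ys (here refl)) = begin
    suc (length xs)           ≤⟨ s≤s (Unique-⊆⇒length≤ xs! xs⊆ys₁++ys₂) ⟩
    suc (length (ys₁ ++ ys₂)) ≡⟨ length-++-sucʳ ys₁ x ys₂ ⟨
    length (ys₁ ++ x ∷ ys₂)   ∎
  where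
  xs⊆ys₁++ys₂ : xs ⊆ ys₁ ++ ys₂
  xs⊆ys₁++ys₂ z∈xs with ∈-++⁻ ys₁ (x∷xs⊆ys (there z∈xs))
  ... | inj₁ z∈ys₁          = ∈-++⁺ˡ z∈ys₁
  ... | inj₂ (here refl)    = ⊥-elim (All.lookup x∉xs z∈xs refl)
  ... | inj₂ (there z∈ys₂)  = ∈-++⁺ʳ ys₁ z∈ys₂

module _ {A : Set} {f g : A → ℕ} (f≤g : ∀ x → f x ≤ g x) where

  sum-map-mono-≤ : ∀ xs → sum (map f xs) ≤ sum (map g xs)
  sum-map-mono-≤ []       = z≤n
  sum-map-mono-≤ (x ∷ xs) = ℕ.+-mono-≤ (f≤g x) (sum-map-mono-≤ xs)

  sum-map-mono-< : ∀ {v xs} → v ∈ xs → f v < g v → sum (map f xs) < sum (map g xs)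
  sum-map-mono-< {xs = _ ∷ xs} (here refl) fv<gv = ℕ.+-mono-<-≤ fv<gv (sum-map-mono-≤ xs)
  sum-map-mono-< {xs = x ∷ _}  (there v∈xs) fv<gv =
    ℕ.+-mono-≤-< (f≤g x) (sum-map-mono-< v∈xs fv<gv)

sum-map-≡0 : {A : Set} {f : A → ℕ} → (∀ x → f x ≡ 0) → ∀ xs → sum (map f xs) ≡ 0
sum-map-≡0 f≡0 []       = refl
sum-map-≡0 f≡0 (x ∷ xs) = cong₂ _+_ (f≡0 x) (sum-map-≡0 f≡0 xs)

-- Comparing with the shifted sum g 1 + ⋯ + g n drops f n (which is 0) and g 0.
sum-applyUpTo-shift-≤ : ∀ (f g : ℕ → ℕ) n → (∀ k → f k ≤ g (suc k)) → f n ≡ 0 →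
                        sum (applyUpTo f (suc n)) ≤ sum (applyUpTo g (suc n))
sum-applyUpTo-shift-≤ f g n f≤g fn≡0 = ℕ.≤-trans (shifted f g n f≤g fn≡0) (ℕ.m≤n+m _ (g 0))
  where
  shifted : ∀ (f g : ℕ → ℕ) n → (∀ k → f k ≤ g (suc k)) → f n ≡ 0 →
            sum (applyUpTo f (suc n)) ≤ sum (applyUpTo (g ∘ suc) n)
  shifted f g zero    _   f0≡0 = ℕ.≤-reflexive (cong (_+ 0) f0≡0)
  shifted f g (suc n) f≤g fn≡0 =
    ℕ.+-mono-≤ (f≤g 0) (shifted (f ∘ suc) (g ∘ suc) n (f≤g ∘ suc) fn≡0)

isTotalOrder-on-injective : ∀ {a b ℓ₁ ℓ₂} {A : Set a} {B : Set b}
                            {_≈_ : Rel B ℓ₁} {_≤_ : Rel B ℓ₂}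
                            (f : A → B) → (∀ {x y} → f x ≈ f y → x ≡ y) →
                            IsTotalOrder _≈_ _≤_ → IsTotalOrder _≡_ (_≤_ on f)
isTotalOrder-on-injective f f-injective ≤-isTotalOrder = record
  { isPartialOrder = record
    { isPreorder = record
      { isEquivalence = isEquivalence
      ; reflexive     = λ { refl → ≤-refl }
      ; trans         = ≤-trans
      }
    ; antisym = λ x≤y y≤x → f-injective (antisym x≤y y≤x)
    }
  ; total = λ x y → total (f x) (f y)
  }
  where
  open IsTotalOrder ≤-isTotalOrder using (antisym; total) renaming (refl to ≤-refl; trans to ≤-trans)

module _ (D : Digraph) where
  open Digraph D

  _⇝_ : Vertex D → Vertex D → Set
  _⇝_ = _⇝⁺_ D

  _⇝*_ : Vertex D → Vertex D → Set
  u ⇝* v = u ≡ v ⊎ u ⇝ v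

  ⇝-⇝*-trans : ∀ {u v w} → u ⇝ v → v ⇝* w → u ⇝ w
  ⇝-⇝*-trans u⇝v (inj₁ refl)        = u⇝v
  ⇝-⇝*-trans u⇝v (inj₂ (edge e))    = step e u⇝v
  ⇝-⇝*-trans u⇝v (inj₂ (step e p))  = step e (⇝-⇝*-trans u⇝v (inj₂ p))

  seqs-suc : ∀ k → seqs D (suc k) ≡ cartesianProductWith _∷_ (allFin m) (seqs D k)
  seqs-suc k = go (allFin m)
    where
    go : ∀ es → concatMap (λ e → map (e ∷_) (seqs D k)) es
              ≡ cartesianProductWith _∷_ es (seqs D k)
    go []       = refl
    go (e ∷ es) = cong (map (e ∷_) (seqs D k) ++_) (go es)

  Unique-seqs : ∀ k → Unique (seqs D k)
  Unique-seqs zero    = [] ∷ []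
  Unique-seqs (suc k) = subst Unique (sym (seqs-suc k))
    (Unique.cartesianProductWith⁺ _∷_ ∷-injective (Unique.allFin⁺ m) (Unique-seqs k))
    where
    ∷-injective : ∀ {e f : Fin m} {es fs} → e ∷ es ≡ f ∷ fs → e ≡ f × es ≡ fs
    ∷-injective refl = refl , refl

  ∈-seqs⇒length : ∀ {k es} → es ∈ seqs D k → length es ≡ k
  ∈-seqs⇒length {zero}  (here refl) = refl
  ∈-seqs⇒length {suc k} es∈
    with _ , _ , _ , fs∈ , refl ←
           ∈-cartesianProductWith⁻ _∷_ (allFin m) (seqs D k) (subst (_ ∈_) (seqs-suc k) es∈)
    = cong suc (∈-seqs⇒length fs∈)

  ∈-seqs : ∀ {k} es → length es ≡ k → es ∈ seqs D k
  ∈-seqs []       refl = here refl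
  ∈-seqs (e ∷ es) refl = subst (_ ∈_) (sym (seqs-suc (length es)))
    (∈-cartesianProductWith⁺ _∷_ (∈-allFin e) (∈-seqs es refl))

  walkEnd-++ : ∀ {u v} es fs → walkEnd D u es ≡ just v → walkEnd D u (es ++ fs) ≡ walkEnd D v fs
  walkEnd-++ []           fs refl = refl
  walkEnd-++ {u} (e ∷ es) fs end with tl e ≟ u
  ... | yes _ = walkEnd-++ es fs end
  ... | no  _ with () ← end

  walkEnd-edge : ∀ e → walkEnd D (tl e) (e ∷ []) ≡ just (hd e)
  walkEnd-edge e with tl e ≟ tl e
  ... | yes _      = refl
  ... | no  tl≢tl  = ⊥-elim (tl≢tl refl)

  walk-⇝*-end : ∀ {u x v} es → walkEnd D u es ≡ just x → v ∈ u ∷ map hd es → v ⇝* x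
  walk-⇝*-end []       refl (here refl) = inj₁ refl
  walk-⇝*-end {u} (e ∷ es) end v∈ with tl e ≟ u
  ... | no  _ with () ← end
  ... | yes refl with v∈
  ...   | here refl = inj₂ (⇝-⇝*-trans (edge e) (walk-⇝*-end es end (here refl)))
  ...   | there v∈′ = walk-⇝*-end es end v∈′

  IsPath⇒⇝* : ∀ {x y es} → IsPath D x y es → x ⇝* y
  IsPath⇒⇝* {es = es} (end , _) = walk-⇝*-end es end (here refl)

  IsPath⇒length< : ∀ {x y es} → IsPath D x y es → length es < n
  IsPath⇒length< {x} {y} {es} (_ , distinct) = begin
    suc (length es)            ≡⟨ cong suc (length-map hd es) ⟨
    length (x ∷ map hd es)     ≤⟨ Unique-⊆⇒length≤ distinct (λ {z} _ → ∈-allFin z) ⟩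
    length (allFin n)          ≡⟨ length-tabulate (λ i → i) ⟩
    n                          ∎

  pathCount : Vertex D → Vertex D → ℕ → ℕ
  pathCount x y k = length (filter (isPath? D x y) (seqs D k))

  numPaths-applyUpTo : ∀ x y → numPaths D x y ≡ sum (applyUpTo (pathCount x y) (suc n))
  numPaths-applyUpTo x y = cong sum (map-applyUpTo (λ k → k) (pathCount x y) (suc n))

  pathCount≡0 : ∀ {x y k} → (∀ {es} → es ∈ seqs D k → ¬ IsPath D x y es) →
                pathCount x y k ≡ 0
  pathCount≡0 {x} {y} noPath = cong length (filter-none (isPath? D x y) (All.tabulate noPath))

  pathCount-n≡0 : ∀ x y → pathCount x y n ≡ 0
  pathCount-n≡0 x y = pathCount≡0 {k = n} λ es∈ path →
    ℕ.<-irrefl (∈-seqs⇒length es∈) (IsPath⇒length< path)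

  numPaths-unreachable : ∀ {x y} → ¬ (x ⇝* y) → numPaths D x y ≡ 0
  numPaths-unreachable ¬x⇝*y =
    sum-map-≡0 (λ k → pathCount≡0 {k = k} (λ _ → ¬x⇝*y ∘ IsPath⇒⇝*)) (upTo (suc n))

  1≤numPaths-refl : ∀ x → 1 ≤ numPaths D x x
  1≤numPaths-refl x = begin
    1                    ≡⟨ cong length (filter-accept (isPath? D x x) (refl , [] ∷ [])) ⟨
    pathCount x x 0      ≤⟨ ℕ.m≤m+n _ _ ⟩
    numPaths D x x       ∎

  module _ (acyclic : Acyclic D) where

    ¬hd⇝*tl : ∀ e → ¬ (hd e ⇝* tl e)
    ¬hd⇝*tl e (inj₁ hd≡tl) = acyclic (tl e) (subst (tl e ⇝_) hd≡tl (edge e))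
    ¬hd⇝*tl e (inj₂ hd⇝tl) = acyclic (hd e) (step e hd⇝tl)

    IsPath-∷ʳ : ∀ {u es} e → IsPath D u (tl e) es → IsPath D u (hd e) (es ∷ʳ e)
    IsPath-∷ʳ {u} {es} e (end , distinct) =
      trans (walkEnd-++ es (e ∷ []) end) (walkEnd-edge e) ,
      subst (λ vs → Unique (u ∷ vs)) (sym (map-++ hd es (e ∷ [])))
        (Unique.++⁺ distinct ([] ∷ [])
          λ { (v∈ , here refl) → ¬hd⇝*tl e (walk-⇝*-end es end v∈) })

    pathCount-∷ʳ-≤ : ∀ u e k → pathCount u (tl e) k ≤ pathCount u (hd e) (suc k)
    pathCount-∷ʳ-≤ u e k = begin
      length paths                ≡⟨ length-map (_∷ʳ e) paths ⟨
      length (map (_∷ʳ e) paths)  ≤⟨ Unique-⊆⇒length≤ distinct extended⊆ ⟩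
      pathCount u (hd e) (suc k)  ∎
      where
      paths = filter (isPath? D u (tl e)) (seqs D k)

      distinct : Unique (map (_∷ʳ e) paths)
      distinct = Unique.map⁺ (∷ʳ-injectiveˡ _ _)
                   (Unique.filter⁺ (isPath? D u (tl e)) (Unique-seqs k))

      extended⊆ : map (_∷ʳ e) paths ⊆ filter (isPath? D u (hd e)) (seqs D (suc k))
      extended⊆ ∈map with es , es∈ , refl ← ∈-map⁻ (_∷ʳ e) ∈map
                       with es∈seqs , path ← ∈-filter⁻ (isPath? D u (tl e)) es∈ =
        ∈-filter⁺ (isPath? D u (hd e)) (∈-seqs (es ∷ʳ e) length-∷ʳ) (IsPath-∷ʳ e path)
        where
        length-∷ʳ : length (es ∷ʳ e) ≡ suc k
        length-∷ʳ = trans (length-++ es)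
                          (trans (ℕ.+-comm (length es) 1) (cong suc (∈-seqs⇒length {k} es∈seqs)))

    numPaths-mono : ∀ u e → numPaths D u (tl e) ≤ numPaths D u (hd e)
    numPaths-mono u e = begin
      numPaths D u (tl e)                           ≡⟨ numPaths-applyUpTo u (tl e) ⟩
      sum (applyUpTo (pathCount u (tl e)) (suc n))  ≤⟨ shift ⟩
      sum (applyUpTo (pathCount u (hd e)) (suc n))  ≡⟨ numPaths-applyUpTo u (hd e) ⟨
      numPaths D u (hd e)                           ∎
      where
      shift = sum-applyUpTo-shift-≤ (pathCount u (tl e)) (pathCount u (hd e)) n
                (pathCount-∷ʳ-≤ u e) (pathCount-n≡0 u (tl e))

    pathsInto : Vertex D → ℕ
    pathsInto x = sum (map (λ u → numPaths D u x) (allFin n))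

    pathsInto-< : ∀ e → pathsInto (tl e) < pathsInto (hd e)
    pathsInto-< e = sum-map-mono-< (λ u → numPaths-mono u e) (∈-allFin (hd e)) (begin-strict
      numPaths D (hd e) (tl e)  ≡⟨ numPaths-unreachable (¬hd⇝*tl e) ⟩
      0                         <⟨ 1≤numPaths-refl (hd e) ⟩
      numPaths D (hd e) (hd e)  ∎)

    module _ (s : Vertex D) where

      key : Vertex D → ℕ × ℕ × Vertex D
      key x = μ D s x , pathsInto x , x

      _⪯_ : Rel (Vertex D) 0ℓ
      _⪯_ = ×-Lex _≡_ _≤_ (×-Lex _≡_ _≤_ _≤ᶠ_) on key

      ⪯-isTotalOrder : IsTotalOrder _≡_ _⪯_
      ⪯-isTotalOrder = isTotalOrder-on-injective key (λ (_ , _ , x≡y) → x≡y)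
        (IsDecTotalOrder.isTotalOrder
          (×-isDecTotalOrder ℕ.≤-isDecTotalOrder
            (×-isDecTotalOrder ℕ.≤-isDecTotalOrder Fin.≤-isDecTotalOrder)))

      tl⪯hd : ∀ e → tl e ⪯ hd e
      tl⪯hd e with μ D s (tl e) ℕ.≟ μ D s (hd e)
      ... | no  μ≢ = inj₁ (numPaths-mono s e , μ≢)
      ... | yes μ≡ = inj₂ (μ≡ , inj₁ (ℕ.<⇒≤ (pathsInto-< e) , ℕ.<⇒≢ (pathsInto-< e)))

      ⪯⇒μ≤ : ∀ x y → x ⪯ y → μ D s x ≤ μ D s y
      ⪯⇒μ≤ x y (inj₁ (μ≤ , _)) = μ≤
      ⪯⇒μ≤ x y (inj₂ (μ≡ , _)) = ℕ.≤-reflexive μ≡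

    tl≢hd : ∀ e → tl e ≢ hd e
    tl≢hd e = ¬hd⇝*tl e ∘ inj₁ ∘ sym

lemma2p2 : (D : Digraph) → (s : Vertex D) →
    ThreeRegular D → Acyclic D → UniqueSource D s → HasUniqueSink D →
    Σ (Rel (Vertex D) 0ℓ) λ _⪯_ →
      IsTotalOrder _≡_ _⪯_ ×
      (∀ (e : Fin (Digraph.m D)) →
        (Digraph.tl D e ⪯ Digraph.hd D e) × (Digraph.tl D e ≢ Digraph.hd D e)) ×
      (∀ x y → x ⪯ y → μ D s x ≤ μ D s y)
lemma2p2 D s _ acyclic _ _ =
  _⪯_ D acyclic s , ⪯-isTotalOrder D acyclic s ,
  (λ e → tl⪯hd D acyclic s e , tl≢hd D acyclic e) , ⪯⇒μ≤ D acyclic s
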